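{- For every integer $k\ge1$, the polynomials $W_{2k+1,k}(t)=\sum_{m=0}^{k}w_{2k+1,k,m}t^m$ and $W_{2k-1,k}(t)=\sum_{m=0}^{k}w_{2k-1,k,m}t^m$ are symmetric.
   Context: A Dyck path of semilength $n$ is a word in the letters $U,D$ with $n$ copies of each letter such that no prefix contains more $D$'s than $U$'s. A $UD$-factor (resp. $UUD$-factor) is an occurrence of $UD$ (resp. $UUD$) as a consecutive subword. $w_{n,k,m}$ denotes the number of Dyck paths of semilength $n$ with exactly $k$ $UD$-factors and exactly $m$ $UUD$-factors. A polynomial $f(t)=\sum_i a_it^i$ is symmetric if there is an integer $d$ such that $a_i=a_{d-i}$ for all $i$ (coefficients with indices out of range being $0$). -}

module Defs where

open import Data.Nat using (ℕ; zero; suc; _+_; _*_; _≤ᵇ_)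
open import Data.Bool using (Bool; true; false; _∧_)
open import Data.List using (List; []; _∷_; length; filter; map; _++_; concatMap)
open import Data.Integer using (ℤ; +_; -[1+_]; _-_)
open import Data.Product using (∃)
open import Relation.Binary.PropositionalEquality using (_≡_)
open import Relation.Nullary.Decidable using (yes; no)
open import Relation.Unary using (Decidable)
open import Data.Bool using (T)
open import Data.Bool.Properties using (T?)

data Step : Set where
  U D : Step

words : ℕ → List (List Step)
words zero = [] ∷ []
words (suc n) = concatMap (λ w → (U ∷ w) ∷ (D ∷ w) ∷ []) (words n)

countU countD : List Step → ℕ
countU [] = 0
countU (U ∷ w) = suc (countU w)
countU (D ∷ w) = countU w
countD [] = 0
countD (U ∷ w) = countD w
countD (D ∷ w) = suc (countD w)

prefixOK : ℕ → List Step → Bool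
prefixOK h [] = true
prefixOK h (U ∷ w) = prefixOK (suc h) w
prefixOK zero (D ∷ w) = false
prefixOK (suc h) (D ∷ w) = prefixOK h w

eqᵇ : ℕ → ℕ → Bool
eqᵇ a b = (a ≤ᵇ b) ∧ (b ≤ᵇ a)

isDyck : ℕ → List Step → Bool
isDyck n w = eqᵇ (countU w) n ∧ eqᵇ (countD w) n ∧ prefixOK 0 w

countUD : List Step → ℕ
countUD [] = 0
countUD (U ∷ D ∷ w) = suc (countUD (D ∷ w))
countUD (_ ∷ w) = countUD w

countUUD : List Step → ℕ
countUUD [] = 0
countUUD (U ∷ U ∷ D ∷ w) = suc (countUUD (U ∷ D ∷ w))
countUUD (_ ∷ w) = countUUD w

w : ℕ → ℕ → ℕ → ℕ
w n k m = length (filter (λ p → T? (isDyck n p ∧ eqᵇ (countUD p) k ∧ eqᵇ (countUUD p) m))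
                         (words (n + n)))

Wcoef : ℕ → ℕ → ℤ → ℕ
Wcoef n k (+ m) = if m ≤ᵇ k then w n k m else 0
  where open import Data.Bool using (if_then_else_)
Wcoef n k -[1+ _ ] = 0

Symmetric : (ℤ → ℕ) → Set
Symmetric a = ∃ λ (d : ℤ) → (i : ℤ) → a i ≡ a (d - i)

module Submission where

-- Among the 2n+1 rotations of a word with n U's and n+1 D's exactly one is a
-- Dyck path followed by D (cycle lemma) and n+1 start with D.  The numbers of
-- UD and UUD factors of the word read cyclically are rotation invariant and
-- are those of the Dyck path, so (n+1)·w(n,k,m) counts the words D·y read
-- cyclically, i.e. the sequences of n+1 runs of U's of total length n with k
-- nonempty runs and m runs of length ≥ 2.  Choosing the nonempty runs, then
-- the long ones, gives (n+1)·w(n,k,m) = C(n+1,k)·C(k,m)·c(m,n−k), where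
-- c(m+1,t+1) = C(t,m) counts compositions.  For n = 2k+1 the m-dependent part
-- is C(k,m)·C(k,m−1), invariant under m ↦ k+1−m; for n = 2k−1 it is
-- C(k,m)·C(k−2,m−1), invariant under m ↦ k−m.

open import Defs
open import Data.Bool using (Bool; true; false; _∧_; T)
open import Data.Bool.Properties using (T?; T-∧)
open import Data.Empty using (⊥; ⊥-elim)
open import Data.Integer as ℤ using (ℤ; -[1+_])
open import Data.Integer.Properties using (m-n≡m⊖n; ≤-⊖; ⊖-<)
open import Data.List using (List; []; _∷_; _∷ʳ_; length; filter; map; _++_; concatMap; replicate; take; drop)
open import Data.List.Properties
  using (++-assoc; ++-identityʳ; length-++; ∷-injective; length-take; length-drop; take++drop≡id)
open import Data.List.Reverse using (reverseView; []; _∶_∶ʳ_)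
open import Data.Nat using (ℕ; zero; suc; _+_; _*_; _∸_; _≤_; _<_; z≤n; s≤s; s≤s⁻¹; _≤ᵇ_; _≡ᵇ_)
open import Data.Nat.Combinatorics using (_C_; nCk+nC[k+1]≡[n+1]C[k+1]; nCk≡nC[n∸k]; k>n⇒nCk≡0)
open import Data.Nat.ListAction using (sum)
open import Data.Nat.Properties
open import Data.Nat.Tactic.RingSolver using (solve-∀)
open import Data.Product using (_×_; ∃; ∃₂; _,_; proj₁; proj₂)
open import Data.Sum using (_⊎_; inj₁; inj₂)
open import Data.Unit using (tt)
open import Function using (_∘_; Equivalence)
open import Relation.Binary.PropositionalEquality
open import Relation.Nullary using (yes; no)
open import Algebra.Properties.CommutativeSemigroup +-commutativeSemigroup
  using () renaming (interchange to +-interchange)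

open ≡-Reasoning

𝟙 : Bool → ℕ
𝟙 true = 1
𝟙 false = 0

T-extensional : ∀ {a b} → (T a → T b) → (T b → T a) → a ≡ b
T-extensional {false} {false} _ _ = refl
T-extensional {false} {true} _ b⇒a = ⊥-elim (b⇒a tt)
T-extensional {true} {false} a⇒b _ = ⊥-elim (a⇒b tt)
T-extensional {true} {true} _ _ = refl

T-∧-intro : ∀ {a b} → T a → T b → T (a ∧ b)
T-∧-intro p q = Equivalence.from T-∧ (p , q)

T-∧-elim : ∀ {a b} → T (a ∧ b) → T a × T b
T-∧-elim = Equivalence.to T-∧

eqᵇ⇒≡ : ∀ a b → T (eqᵇ a b) → a ≡ b
eqᵇ⇒≡ a b p = let (a≤b , b≤a) = T-∧-elim p in ≤-antisym (≤ᵇ⇒≤ a b a≤b) (≤ᵇ⇒≤ b a b≤a)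

≡⇒eqᵇ : ∀ a b → a ≡ b → T (eqᵇ a b)
≡⇒eqᵇ a b refl = T-∧-intro (≤⇒≤ᵇ (≤-refl {a})) (≤⇒≤ᵇ (≤-refl {a}))

sumBelow : ℕ → (ℕ → ℕ) → ℕ
sumBelow zero g = 0
sumBelow (suc L) g = g 0 + sumBelow L (g ∘ suc)

sumBelow-cong : ∀ L {g h} → (∀ r → r < L → g r ≡ h r) → sumBelow L g ≡ sumBelow L h
sumBelow-cong zero e = refl
sumBelow-cong (suc L) e = cong₂ _+_ (e 0 (s≤s z≤n)) (sumBelow-cong L (λ r r<L → e (suc r) (s≤s r<L)))

sumBelow-zero : ∀ L {g} → (∀ r → r < L → g r ≡ 0) → sumBelow L g ≡ 0
sumBelow-zero zero e = refl
sumBelow-zero (suc L) e = cong₂ _+_ (e 0 (s≤s z≤n)) (sumBelow-zero L (λ r r<L → e (suc r) (s≤s r<L)))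

sumBelow-const : ∀ L c → sumBelow L (λ _ → c) ≡ L * c
sumBelow-const zero c = refl
sumBelow-const (suc L) c = cong (c +_) (sumBelow-const L c)

sumBelow-*ˡ : ∀ L c g → sumBelow L (λ r → c * g r) ≡ c * sumBelow L g
sumBelow-*ˡ zero c g = sym (*-zeroʳ c)
sumBelow-*ˡ (suc L) c g = trans (cong (c * g 0 +_) (sumBelow-*ˡ L c (g ∘ suc))) (sym (*-distribˡ-+ c _ _))

sumBelow-+ : ∀ a b g → sumBelow (a + b) g ≡ sumBelow a g + sumBelow b (λ r → g (a + r))
sumBelow-+ zero b g = refl
sumBelow-+ (suc a) b g = trans (cong (g 0 +_) (sumBelow-+ a b (g ∘ suc))) (sym (+-assoc (g 0) _ _))

𝟙-true : ∀ {b} → T b → 𝟙 b ≡ 1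
𝟙-true {true} _ = refl

𝟙-false : ∀ {b} → (T b → ⊥) → 𝟙 b ≡ 0
𝟙-false {false} _ = refl
𝟙-false {true} ¬b = ⊥-elim (¬b tt)

sumBelow-𝟙-unique : ∀ L (g : ℕ → Bool) r₀ → r₀ < L → T (g r₀) →
  (∀ r s → r < s → s < L → T (g r) → T (g s) → ⊥) → sumBelow L (𝟙 ∘ g) ≡ 1
sumBelow-𝟙-unique (suc L) g zero _ g0 unique =
  cong₂ _+_ (𝟙-true g0) (sumBelow-zero L λ r r<L → 𝟙-false (unique 0 (suc r) (s≤s z≤n) (s≤s r<L) g0))
sumBelow-𝟙-unique (suc L) g (suc r₀) (s≤s r₀<L) gr₀ unique with g 0 in g0
... | true = ⊥-elim (unique 0 (suc r₀) (s≤s z≤n) (s≤s r₀<L) (subst T (sym g0) tt) gr₀)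
... | false = sumBelow-𝟙-unique L (g ∘ suc) r₀ r₀<L gr₀
                (λ r s r<s s<L → unique (suc r) (suc s) (s≤s r<s) (s≤s s<L))

sumWords : ℕ → (List Step → ℕ) → ℕ
sumWords L h = sum (map h (words L))

length-filter-T? : ∀ {A : Set} (b : A → Bool) xs → length (filter (T? ∘ b) xs) ≡ sum (map (𝟙 ∘ b) xs)
length-filter-T? b [] = refl
length-filter-T? b (x ∷ xs) with b x
... | true = cong suc (length-filter-T? b xs)
... | false = length-filter-T? b xs

sumWords-suc : ∀ L h → sumWords (suc L) h ≡ sumWords L (h ∘ (U ∷_)) + sumWords L (h ∘ (D ∷_))
sumWords-suc L h = go (words L)
  where
  go : ∀ ws → sum (map h (concatMap (λ w → (U ∷ w) ∷ (D ∷ w) ∷ []) ws))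
            ≡ sum (map (h ∘ (U ∷_)) ws) + sum (map (h ∘ (D ∷_)) ws)
  go [] = refl
  go (x ∷ ws) = trans (cong (λ s → h (U ∷ x) + (h (D ∷ x) + s)) (go ws))
                      (interchange (h (U ∷ x)) (h (D ∷ x)) _ _)
    where
    interchange : ∀ a b c d → a + (b + (c + d)) ≡ (a + c) + (b + d)
    interchange = solve-∀

sumWords-cong : ∀ L {h g : List Step → ℕ} → (∀ x → length x ≡ L → h x ≡ g x) → sumWords L h ≡ sumWords L g
sumWords-cong zero e = cong (_+ 0) (e [] refl)
sumWords-cong (suc L) {h} {g} e = begin
  sumWords (suc L) h                                    ≡⟨ sumWords-suc L h ⟩
  sumWords L (h ∘ (U ∷_)) + sumWords L (h ∘ (D ∷_))
    ≡⟨ cong₂ _+_ (sumWords-cong L λ x lx → e (U ∷ x) (cong suc lx))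
                 (sumWords-cong L λ x lx → e (D ∷ x) (cong suc lx)) ⟩
  sumWords L (g ∘ (U ∷_)) + sumWords L (g ∘ (D ∷_))    ≡⟨ sumWords-suc L g ⟨
  sumWords (suc L) g                                    ∎

sumWords-zero : ∀ L {h} → (∀ x → length x ≡ L → h x ≡ 0) → sumWords L h ≡ 0
sumWords-zero zero e = cong (_+ 0) (e [] refl)
sumWords-zero (suc L) {h} e = trans (sumWords-suc L h)
  (cong₂ _+_ (sumWords-zero L λ x lx → e (U ∷ x) (cong suc lx))
             (sumWords-zero L λ x lx → e (D ∷ x) (cong suc lx)))

sumWords-+ : ∀ L (h g : List Step → ℕ) → sumWords L (λ x → h x + g x) ≡ sumWords L h + sumWords L g
sumWords-+ zero h g = solve (h []) (g [])
  where solve : ∀ a b → a + b + 0 ≡ (a + 0) + (b + 0)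
        solve = solve-∀
sumWords-+ (suc L) h g = begin
  sumWords (suc L) (λ x → h x + g x)
    ≡⟨ sumWords-suc L _ ⟩
  sumWords L (λ x → h (U ∷ x) + g (U ∷ x)) + sumWords L (λ x → h (D ∷ x) + g (D ∷ x))
    ≡⟨ cong₂ _+_ (sumWords-+ L _ _) (sumWords-+ L _ _) ⟩
  (hU + gU) + (hD + gD)
    ≡⟨ +-interchange hU gU hD gD ⟩
  (hU + hD) + (gU + gD)
    ≡⟨ cong₂ _+_ (sumWords-suc L h) (sumWords-suc L g) ⟨
  sumWords (suc L) h + sumWords (suc L) g ∎
  where
  hU = sumWords L (h ∘ (U ∷_))
  hD = sumWords L (h ∘ (D ∷_))
  gU = sumWords L (g ∘ (U ∷_))
  gD = sumWords L (g ∘ (D ∷_))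

sumWords-*ˡ : ∀ L c (h : List Step → ℕ) → sumWords L (λ x → c * h x) ≡ c * sumWords L h
sumWords-*ˡ zero c h = solve c (h [])
  where solve : ∀ c a → c * a + 0 ≡ c * (a + 0)
        solve = solve-∀
sumWords-*ˡ (suc L) c h = begin
  sumWords (suc L) (λ x → c * h x)                          ≡⟨ sumWords-suc L _ ⟩
  sumWords L (λ x → c * h (U ∷ x)) + sumWords L (λ x → c * h (D ∷ x))
    ≡⟨ cong₂ _+_ (sumWords-*ˡ L c _) (sumWords-*ˡ L c _) ⟩
  c * sumWords L (h ∘ (U ∷_)) + c * sumWords L (h ∘ (D ∷_)) ≡⟨ *-distribˡ-+ c _ _ ⟨
  c * (sumWords L (h ∘ (U ∷_)) + sumWords L (h ∘ (D ∷_)))   ≡⟨ cong (c *_) (sumWords-suc L h) ⟨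
  c * sumWords (suc L) h                                     ∎

sumWords-∷ʳ : ∀ L h → sumWords (suc L) h ≡ sumWords L (h ∘ (_∷ʳ U)) + sumWords L (h ∘ (_∷ʳ D))
sumWords-∷ʳ zero h = solve (h (U ∷ [])) (h (D ∷ []))
  where solve : ∀ a b → a + (b + 0) ≡ (a + 0) + (b + 0)
        solve = solve-∀
sumWords-∷ʳ (suc L) h = begin
  sumWords (suc (suc L)) h
    ≡⟨ sumWords-suc (suc L) h ⟩
  sumWords (suc L) (h ∘ (U ∷_)) + sumWords (suc L) (h ∘ (D ∷_))
    ≡⟨ cong₂ _+_ (sumWords-∷ʳ L _) (sumWords-∷ʳ L _) ⟩
  (sUU + sUD) + (sDU + sDD)
    ≡⟨ +-interchange sUU sUD sDU sDD ⟩
  (sUU + sDU) + (sUD + sDD)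
    ≡⟨ cong₂ _+_ (sumWords-suc L (h ∘ (_∷ʳ U))) (sumWords-suc L (h ∘ (_∷ʳ D))) ⟨
  sumWords (suc L) (h ∘ (_∷ʳ U)) + sumWords (suc L) (h ∘ (_∷ʳ D)) ∎
  where
  sUU = sumWords L (λ x → h (U ∷ x ∷ʳ U))
  sUD = sumWords L (λ x → h (U ∷ x ∷ʳ D))
  sDU = sumWords L (λ x → h (D ∷ x ∷ʳ U))
  sDD = sumWords L (λ x → h (D ∷ x ∷ʳ D))

sumWords-sumBelow : ∀ R L (g : ℕ → List Step → ℕ) →
  sumWords L (λ x → sumBelow R (λ r → g r x)) ≡ sumBelow R (λ r → sumWords L (g r))
sumWords-sumBelow zero L g = sumWords-zero L (λ _ _ → refl)
sumWords-sumBelow (suc R) L g =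
  trans (sumWords-+ L _ _) (cong (sumWords L (g 0) +_) (sumWords-sumBelow R L (g ∘ suc)))

rotate₁ : List Step → List Step
rotate₁ [] = []
rotate₁ (a ∷ x) = x ∷ʳ a

rotate : ℕ → List Step → List Step
rotate zero x = x
rotate (suc r) x = rotate r (rotate₁ x)

rotate-+ : ∀ a b x → rotate (a + b) x ≡ rotate b (rotate a x)
rotate-+ zero b x = refl
rotate-+ (suc a) b x = rotate-+ a b (rotate₁ x)

rotate-++ : ∀ A B → rotate (length A) (A ++ B) ≡ B ++ A
rotate-++ [] B = sym (++-identityʳ B)
rotate-++ (a ∷ A) B = begin
  rotate (length A) ((A ++ B) ∷ʳ a) ≡⟨ cong (rotate (length A)) (++-assoc A B (a ∷ [])) ⟩
  rotate (length A) (A ++ B ∷ʳ a)   ≡⟨ rotate-++ A (B ∷ʳ a) ⟩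
  (B ∷ʳ a) ++ A                     ≡⟨ ++-assoc B (a ∷ []) A ⟩
  B ++ a ∷ A                        ∎

length-rotate : ∀ r x → length (rotate r x) ≡ length x
length-rotate zero x = refl
length-rotate (suc r) [] = length-rotate r []
length-rotate (suc r) (a ∷ x) = trans (length-rotate r (x ∷ʳ a)) (trans (length-++ x) (+-comm (length x) 1))

sumWords-rotate₁ : ∀ L h → sumWords L (h ∘ rotate₁) ≡ sumWords L h
sumWords-rotate₁ zero h = refl
sumWords-rotate₁ (suc L) h = trans (sumWords-suc L _) (sym (sumWords-∷ʳ L h))

sumWords-rotate : ∀ r L h → sumWords L (h ∘ rotate r) ≡ sumWords L h
sumWords-rotate zero L h = refl
sumWords-rotate (suc r) L h = trans (sumWords-rotate₁ L (h ∘ rotate r)) (sumWords-rotate r L h)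

-- Both sides count the pairs (x, r) with R x and Q (rotate r x): sums over
-- all words are invariant under rotation.
sumWords-rotation-orbits : ∀ L (R Q : List Step → Bool) c → (∀ x → R (rotate₁ x) ≡ R x) →
  (∀ x → length x ≡ L → T (R x) → sumBelow L (λ r → 𝟙 (Q (rotate r x))) ≡ c) →
  c * sumWords L (𝟙 ∘ R) ≡ L * sumWords L (λ x → 𝟙 (R x ∧ Q x))
sumWords-rotation-orbits L R Q c R-rotate₁ orbit = begin
  c * sumWords L (𝟙 ∘ R)
    ≡⟨ sumWords-*ˡ L c (𝟙 ∘ R) ⟨
  sumWords L (λ x → c * 𝟙 (R x))
    ≡⟨ sumWords-cong L orbit-sum ⟩
  sumWords L (λ x → sumBelow L (λ r → 𝟙 (R x ∧ Q (rotate r x))))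
    ≡⟨ sumWords-sumBelow L L (λ r x → 𝟙 (R x ∧ Q (rotate r x))) ⟩
  sumBelow L (λ r → sumWords L (λ x → 𝟙 (R x ∧ Q (rotate r x))))
    ≡⟨ sumBelow-cong L (λ r _ → sumWords-cong L λ x _ → cong (λ b → 𝟙 (b ∧ _)) (sym (R-rotate r x))) ⟩
  sumBelow L (λ r → sumWords L (λ x → 𝟙 (R (rotate r x) ∧ Q (rotate r x))))
    ≡⟨ sumBelow-cong L (λ r _ → sumWords-rotate r L (λ y → 𝟙 (R y ∧ Q y))) ⟩
  sumBelow L (λ _ → sumWords L (λ x → 𝟙 (R x ∧ Q x)))
    ≡⟨ sumBelow-const L _ ⟩
  L * sumWords L (λ x → 𝟙 (R x ∧ Q x)) ∎
  where
  R-rotate : ∀ r x → R (rotate r x) ≡ R x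
  R-rotate zero x = refl
  R-rotate (suc r) x = trans (R-rotate r (rotate₁ x)) (R-rotate₁ x)
  orbit-sum : ∀ x → length x ≡ L → c * 𝟙 (R x) ≡ sumBelow L (λ r → 𝟙 (R x ∧ Q (rotate r x)))
  orbit-sum x lx with R x in Rx
  ... | true = trans (*-identityʳ c) (sym (orbit x lx (subst T (sym Rx) tt)))
  ... | false = trans (*-zeroʳ c) (sym (sumBelow-zero L (λ _ _ → refl)))

-- The cycle lemma

countU-++ : ∀ u v → countU (u ++ v) ≡ countU u + countU v
countU-++ [] v = refl
countU-++ (U ∷ u) v = cong suc (countU-++ u v)
countU-++ (D ∷ u) v = countU-++ u v

countD-++ : ∀ u v → countD (u ++ v) ≡ countD u + countD v
countD-++ [] v = refl
countD-++ (U ∷ u) v = countD-++ u v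
countD-++ (D ∷ u) v = cong suc (countD-++ u v)

-- exitsAtEnd h y: started at height h, the path y stays at height ≥ 0 and
-- reaches height −1 exactly with its last step.  For h = 0 these are the
-- words p ∷ʳ D with p a Dyck path.
exitsAtEnd : ℕ → List Step → Bool
exitsAtEnd h [] = false
exitsAtEnd h (U ∷ y) = exitsAtEnd (suc h) y
exitsAtEnd zero (D ∷ []) = true
exitsAtEnd zero (D ∷ _ ∷ _) = false
exitsAtEnd (suc h) (D ∷ y) = exitsAtEnd h y

exitsAtEnd-counts : ∀ h y → T (exitsAtEnd h y) → countD y ≡ suc (h + countU y)
exitsAtEnd-counts h (U ∷ y) e = trans (exitsAtEnd-counts (suc h) y e) (cong suc (sym (+-suc h (countU y))))
exitsAtEnd-counts zero (D ∷ []) e = refl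
exitsAtEnd-counts (suc h) (D ∷ y) e = cong suc (exitsAtEnd-counts h y e)

prefixOK-counts : ∀ h u → T (prefixOK h u) → countD u ≤ h + countU u
prefixOK-counts h [] _ = z≤n
prefixOK-counts h (U ∷ u) ok = subst (countD u ≤_) (sym (+-suc h (countU u))) (prefixOK-counts (suc h) u ok)
prefixOK-counts (suc h) (D ∷ u) ok = s≤s (prefixOK-counts h u ok)

exitsAtEnd-prefix : ∀ h u c v → T (exitsAtEnd h (u ++ c ∷ v)) → T (prefixOK h u)
exitsAtEnd-prefix h [] c v e = tt
exitsAtEnd-prefix h (U ∷ u) c v e = exitsAtEnd-prefix (suc h) u c v e
exitsAtEnd-prefix zero (D ∷ []) c v ()
exitsAtEnd-prefix zero (D ∷ _ ∷ _) c v ()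
exitsAtEnd-prefix (suc h) (D ∷ u) c v e = exitsAtEnd-prefix h u c v e

exitsAtEnd-∷ʳD : ∀ h p → T (prefixOK h p) → countD p ≡ h + countU p → T (exitsAtEnd h (p ∷ʳ D))
exitsAtEnd-∷ʳD zero [] ok e = tt
exitsAtEnd-∷ʳD h (U ∷ p) ok e = exitsAtEnd-∷ʳD (suc h) p ok (trans e (+-suc h (countU p)))
exitsAtEnd-∷ʳD (suc h) (D ∷ p) ok e = exitsAtEnd-∷ʳD h p ok (suc-injective e)

exitsAtEnd-∷ʳU : ∀ h p → T (exitsAtEnd h (p ∷ʳ U)) → ⊥
exitsAtEnd-∷ʳU h (U ∷ p) e = exitsAtEnd-∷ʳU (suc h) p e
exitsAtEnd-∷ʳU zero (D ∷ []) ()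
exitsAtEnd-∷ʳU zero (D ∷ _ ∷ _) ()
exitsAtEnd-∷ʳU (suc h) (D ∷ p) e = exitsAtEnd-∷ʳU h p e

exitsAtEnd-insertUD : ∀ h u c v → T (exitsAtEnd h (u ++ c ∷ v)) → T (exitsAtEnd h (u ++ U ∷ D ∷ c ∷ v))
exitsAtEnd-insertUD h [] c v e = e
exitsAtEnd-insertUD h (U ∷ u) c v e = exitsAtEnd-insertUD (suc h) u c v e
exitsAtEnd-insertUD zero (D ∷ []) c v ()
exitsAtEnd-insertUD zero (D ∷ _ ∷ _) c v ()
exitsAtEnd-insertUD (suc h) (D ∷ u) c v e = exitsAtEnd-insertUD h u c v e

-- The prefixes M and N of the two words have nonnegative height, while M ++ N
-- ends at height −1.
exitsAtEnd-rotation-unique : ∀ M N → M ≢ [] → N ≢ [] →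
  T (exitsAtEnd 0 (M ++ N)) → T (exitsAtEnd 0 (N ++ M)) → ⊥
exitsAtEnd-rotation-unique [] N M≢[] _ _ _ = M≢[] refl
exitsAtEnd-rotation-unique M [] _ N≢[] _ _ = N≢[] refl
exitsAtEnd-rotation-unique (m ∷ M) (n ∷ N) _ _ MN NM =
  1+n≰n (subst (_≤ countU M′ + countU N′) D-excess
          (+-mono-≤ (prefixOK-counts 0 M′ (exitsAtEnd-prefix 0 M′ n N MN))
                    (prefixOK-counts 0 N′ (exitsAtEnd-prefix 0 N′ m M NM))))
  where
  M′ = m ∷ M
  N′ = n ∷ N
  D-excess : countD M′ + countD N′ ≡ suc (countU M′ + countU N′)
  D-excess = begin
    countD M′ + countD N′       ≡⟨ countD-++ M′ N′ ⟨
    countD (M′ ++ N′)           ≡⟨ exitsAtEnd-counts 0 (M′ ++ N′) MN ⟩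
    suc (countU (M′ ++ N′))     ≡⟨ cong suc (countU-++ M′ N′) ⟩
    suc (countU M′ + countU N′) ∎

UD-factor-or-Dᵃ-Uᵇ : ∀ x →
  (∃₂ λ X Y → x ≡ X ++ U ∷ D ∷ Y) ⊎ (∃₂ λ a b → x ≡ replicate a D ++ replicate b U)
UD-factor-or-Dᵃ-Uᵇ [] = inj₂ (0 , 0 , refl)
UD-factor-or-Dᵃ-Uᵇ (D ∷ x) with UD-factor-or-Dᵃ-Uᵇ x
... | inj₁ (X , Y , refl) = inj₁ (D ∷ X , Y , refl)
... | inj₂ (a , b , refl) = inj₂ (suc a , b , refl)
UD-factor-or-Dᵃ-Uᵇ (U ∷ x) with UD-factor-or-Dᵃ-Uᵇ x
... | inj₁ (X , Y , refl) = inj₁ (U ∷ X , Y , refl)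
... | inj₂ (zero , b , refl) = inj₂ (0 , suc b , refl)
... | inj₂ (suc a , b , refl) = inj₁ ([] , replicate a D ++ replicate b U , refl)

countU-insertUD : ∀ X Y → countU (X ++ U ∷ D ∷ Y) ≡ suc (countU (X ++ Y))
countU-insertUD [] Y = refl
countU-insertUD (U ∷ X) Y = cong suc (countU-insertUD X Y)
countU-insertUD (D ∷ X) Y = countU-insertUD X Y

countD-insertUD : ∀ X Y → countD (X ++ U ∷ D ∷ Y) ≡ suc (countD (X ++ Y))
countD-insertUD [] Y = refl
countD-insertUD (U ∷ X) Y = countD-insertUD X Y
countD-insertUD (D ∷ X) Y = cong suc (countD-insertUD X Y)

length-insertUD : ∀ X Y → length (X ++ U ∷ D ∷ Y) ≡ suc (suc (length (X ++ Y)))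
length-insertUD [] Y = refl
length-insertUD (_ ∷ X) Y = cong suc (length-insertUD X Y)

countD-Dᵃ-Uᵇ : ∀ a b → countD (replicate a D ++ replicate b U) ≡ a
countD-Dᵃ-Uᵇ (suc a) b = cong suc (countD-Dᵃ-Uᵇ a b)
countD-Dᵃ-Uᵇ zero zero = refl
countD-Dᵃ-Uᵇ zero (suc b) = countD-Dᵃ-Uᵇ zero b

countU-Dᵃ-Uᵇ : ∀ a b → countU (replicate a D ++ replicate b U) ≡ b
countU-Dᵃ-Uᵇ (suc a) b = countU-Dᵃ-Uᵇ a b
countU-Dᵃ-Uᵇ zero zero = refl
countU-Dᵃ-Uᵇ zero (suc b) = cong suc (countU-Dᵃ-Uᵇ zero b)

exitsAtEnd-Uᵇ-Dᵇ⁺ʰ⁺¹ : ∀ b h → T (exitsAtEnd h (replicate b U ++ D ∷ replicate (b + h) D))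
exitsAtEnd-Uᵇ-Dᵇ⁺ʰ⁺¹ zero h = descend h
  where
  descend : ∀ h → T (exitsAtEnd h (D ∷ replicate h D))
  descend zero = tt
  descend (suc h) = descend h
exitsAtEnd-Uᵇ-Dᵇ⁺ʰ⁺¹ (suc b) h =
  subst (λ k → T (exitsAtEnd (suc h) (replicate b U ++ D ∷ replicate k D))) (+-suc b h) (exitsAtEnd-Uᵇ-Dᵇ⁺ʰ⁺¹ b (suc h))

ExitingRotation : List Step → Set
ExitingRotation x = ∃₂ λ A B → x ≡ A ++ B × T (exitsAtEnd 0 (B ++ A))

exitingRotation-Dᵃ-Uᵇ : ∀ a b → countD (replicate a D ++ replicate b U) ≡ suc (countU (replicate a D ++ replicate b U)) →
  ExitingRotation (replicate a D ++ replicate b U)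
exitingRotation-Dᵃ-Uᵇ a b balance = replicate a D , replicate b U , refl ,
  subst (λ a → T (exitsAtEnd 0 (replicate b U ++ replicate a D))) (sym a≡1+b)
    (subst (λ k → T (exitsAtEnd 0 (replicate b U ++ D ∷ replicate k D))) (+-identityʳ b) (exitsAtEnd-Uᵇ-Dᵇ⁺ʰ⁺¹ b 0))
  where
  a≡1+b : a ≡ suc b
  a≡1+b = trans (sym (countD-Dᵃ-Uᵇ a b)) (trans balance (cong suc (countU-Dᵃ-Uᵇ a b)))

++-split : ∀ (X Y A B : List Step) → X ++ Y ≡ A ++ B →
  (∃ λ W → X ≡ A ++ W × B ≡ W ++ Y) ⊎ (∃₂ λ e E → A ≡ X ++ e ∷ E × Y ≡ e ∷ E ++ B)
++-split X Y [] B eq = inj₁ (X , refl , sym eq)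
++-split [] Y (a ∷ A) B eq = inj₂ (a , A , refl , eq)
++-split (x ∷ X) Y (a ∷ A) B eq with ∷-injective eq
... | refl , eq′ with ++-split X Y A B eq′
...   | inj₁ (W , refl , refl) = inj₁ (W , refl , refl)
...   | inj₂ (e , E , refl , refl) = inj₂ (e , E , refl , refl)

exitsAtEnd-subst : ∀ {x y} → x ≡ y → T (exitsAtEnd 0 x) → T (exitsAtEnd 0 y)
exitsAtEnd-subst = subst (T ∘ exitsAtEnd 0)

exitingRotation-insertUD : ∀ X Y → ExitingRotation (X ++ Y) → ExitingRotation (X ++ U ∷ D ∷ Y)
exitingRotation-insertUD X Y (A , B , eq , exits) with ++-split X Y A B eq
... | inj₁ (W , refl , refl) = cut-before A W Y exits
  where
  insert : ∀ A W Y c v → Y ++ A ≡ c ∷ v → T (exitsAtEnd 0 ((W ++ Y) ++ A)) →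
    ExitingRotation ((A ++ W) ++ U ∷ D ∷ Y)
  insert A W Y c v YA≡cv exits = A , W ++ U ∷ D ∷ Y , ++-assoc A W _ ,
    exitsAtEnd-subst (trans (cong (λ z → W ++ U ∷ D ∷ z) (sym YA≡cv)) (sym (++-assoc W (U ∷ D ∷ Y) A)))
      (exitsAtEnd-insertUD 0 W c v (exitsAtEnd-subst (trans (++-assoc W Y A) (cong (W ++_) YA≡cv)) exits))
  cut-before : ∀ A W Y → T (exitsAtEnd 0 ((W ++ Y) ++ A)) → ExitingRotation ((A ++ W) ++ U ∷ D ∷ Y)
  cut-before [] W [] exits = W , U ∷ D ∷ [] , refl ,
    exitsAtEnd-subst (trans (++-identityʳ (W ++ [])) (++-identityʳ W)) exits
  cut-before A W (y ∷ Y) = insert A W (y ∷ Y) y (Y ++ A) refl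
  cut-before (a ∷ A) W [] = insert (a ∷ A) W [] a A refl
... | inj₂ (e , E , refl , refl) = X ++ U ∷ D ∷ e ∷ E , B , sym (++-assoc X (U ∷ D ∷ e ∷ E) B) ,
  exitsAtEnd-subst (++-assoc B X _)
    (exitsAtEnd-insertUD 0 (B ++ X) e E (exitsAtEnd-subst (sym (++-assoc B X (e ∷ E))) exits))

-- Delete a UD factor, find an exiting rotation by induction, and reinsert the
-- factor; a word without UD factor is Dᵃ Uᵇ.
exitingRotation : ∀ n x → length x ≤ n → countD x ≡ suc (countU x) → ExitingRotation x
exitingRotation n x _ balance with UD-factor-or-Dᵃ-Uᵇ x
... | inj₂ (a , b , refl) = exitingRotation-Dᵃ-Uᵇ a b balance
exitingRotation zero _ short _ | inj₁ (X , Y , refl) with () ← subst (_≤ 0) (length-insertUD X Y) short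
exitingRotation (suc n) _ short balance | inj₁ (X , Y , refl) =
  exitingRotation-insertUD X Y (exitingRotation n (X ++ Y) shorter balance′)
  where
  shorter : length (X ++ Y) ≤ n
  shorter = ≤-trans (n≤1+n _) (s≤s⁻¹ (subst (_≤ suc n) (length-insertUD X Y) short))
  balance′ : countD (X ++ Y) ≡ suc (countU (X ++ Y))
  balance′ = suc-injective (trans (sym (countD-insertUD X Y)) (trans balance (cong suc (countU-insertUD X Y))))

exitingRotation-index : ∀ x → countD x ≡ suc (countU x) →
  ∃ λ r → r < length x × T (exitsAtEnd 0 (rotate r x))
exitingRotation-index x balance with exitingRotation (length x) x ≤-refl balance
... | A@(_ ∷ _) , [] , refl , exits = 0 , s≤s z≤n , exitsAtEnd-subst (sym (++-identityʳ A)) exits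
... | A , b ∷ B , refl , exits = length A ,
  subst (length A <_) (sym (length-++ A)) (m<m+n (length A) (s≤s z≤n)) ,
  exitsAtEnd-subst (sym (rotate-++ A (b ∷ B))) exits

no-proper-rotation-exits : ∀ d y → 0 < d → d < length y →
  T (exitsAtEnd 0 y) → T (exitsAtEnd 0 (rotate d y)) → ⊥
no-proper-rotation-exits d y 0<d d<|y| exits exits′ =
  exitsAtEnd-rotation-unique (take d y) (drop d y) take≢[] drop≢[]
    (exitsAtEnd-subst (sym (take++drop≡id d y)) exits)
    (exitsAtEnd-subst rotated exits′)
  where
  |take| : length (take d y) ≡ d
  |take| = trans (length-take d y) (m≤n⇒m⊓n≡m (<⇒≤ d<|y|))
  take≢[] : take d y ≢ []
  take≢[] eq = <-irrefl (trans (sym (cong length eq)) |take|) 0<d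
  drop≢[] : drop d y ≢ []
  drop≢[] eq = <⇒≱ d<|y| (m∸n≡0⇒m≤n (trans (sym (length-drop d y)) (cong length eq)))
  rotated : rotate d y ≡ drop d y ++ take d y
  rotated = trans (cong₂ rotate (sym |take|) (sym (take++drop≡id d y))) (rotate-++ (take d y) (drop d y))

exitingRotation-unique : ∀ x r s → r < s → s < length x →
  T (exitsAtEnd 0 (rotate r x)) → T (exitsAtEnd 0 (rotate s x)) → ⊥
exitingRotation-unique x r s r<s s<|x| exits exits′ =
  no-proper-rotation-exits (s ∸ r) (rotate r x) (m<n⇒0<n∸m r<s)
    (subst (s ∸ r <_) (sym (length-rotate r x)) (≤-<-trans (m∸n≤m s r) s<|x|))
    exits (exitsAtEnd-subst rotated exits′)
  where
  rotated : rotate s x ≡ rotate (s ∸ r) (rotate r x)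
  rotated = trans (cong (λ k → rotate k x) (sym (m+[n∸m]≡n (<⇒≤ r<s)))) (rotate-+ r (s ∸ r) x)

cycle-lemma : ∀ x → countD x ≡ suc (countU x) → sumBelow (length x) (λ r → 𝟙 (exitsAtEnd 0 (rotate r x))) ≡ 1
cycle-lemma x balance =
  let r₀ , r₀<|x| , exits = exitingRotation-index x balance
  in sumBelow-𝟙-unique (length x) (λ r → exitsAtEnd 0 (rotate r x)) r₀ r₀<|x| exits (exitingRotation-unique x)

startsWithD : List Step → Bool
startsWithD (D ∷ _) = true
startsWithD _ = false

sumBelow-startsWithD-rotate : ∀ x → sumBelow (length x) (λ r → 𝟙 (startsWithD (rotate r x))) ≡ countD x
sumBelow-startsWithD-rotate x = trans (cong (heads (length x)) (sym (++-identityʳ x))) (go x [])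
  where
  heads : ℕ → List Step → ℕ
  heads L y = sumBelow L (λ r → 𝟙 (startsWithD (rotate r y)))
  go : ∀ B A → heads (length B) (B ++ A) ≡ countD B
  go [] A = refl
  go (U ∷ B) A = trans (cong (heads (length B)) (++-assoc B A (U ∷ []))) (go B (A ∷ʳ U))
  go (D ∷ B) A = cong suc (trans (cong (heads (length B)) (++-assoc B A (D ∷ []))) (go B (A ∷ʳ D)))

cyclicUD cyclicUUD : List Step → ℕ
cyclicUD x = countUD (x ++ take 1 x)
cyclicUUD x = countUUD (x ++ take 2 x)

isUD : Step → Step → ℕ
isUD U D = 1
isUD _ _ = 0

isUUD : Step → Step → Step → ℕ
isUUD U U D = 1
isUUD _ _ _ = 0

-- The junk value D makes isUD (final []) _ and isUUD (final []) _ _ vanish.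
final : List Step → Step
final [] = D
final (a ∷ []) = a
final (_ ∷ b ∷ w) = final (b ∷ w)

final-∷ʳ : ∀ w a → final (w ∷ʳ a) ≡ a
final-∷ʳ [] a = refl
final-∷ʳ (b ∷ []) a = refl
final-∷ʳ (b ∷ c ∷ w) a = final-∷ʳ (c ∷ w) a

countUD-∷∷ : ∀ a b t → countUD (a ∷ b ∷ t) ≡ isUD a b + countUD (b ∷ t)
countUD-∷∷ U U t = refl
countUD-∷∷ U D t = refl
countUD-∷∷ D b t = refl

headUUD : Step → Step → List Step → ℕ
headUUD a b [] = 0
headUUD a b (c ∷ _) = isUUD a b c

countUUD-∷∷ : ∀ a b t → countUUD (a ∷ b ∷ t) ≡ headUUD a b t + countUUD (b ∷ t)
countUUD-∷∷ U U [] = refl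
countUUD-∷∷ U U (U ∷ t) = refl
countUUD-∷∷ U U (D ∷ t) = refl
countUUD-∷∷ U D [] = refl
countUUD-∷∷ U D (_ ∷ t) = refl
countUUD-∷∷ D b [] = refl
countUUD-∷∷ D b (_ ∷ t) = refl

countUD-∷ʳ : ∀ w a → countUD (w ∷ʳ a) ≡ countUD w + isUD (final w) a
countUD-∷ʳ [] U = refl
countUD-∷ʳ [] D = refl
countUD-∷ʳ (U ∷ []) U = refl
countUD-∷ʳ (U ∷ []) D = refl
countUD-∷ʳ (D ∷ []) U = refl
countUD-∷ʳ (D ∷ []) D = refl
countUD-∷ʳ (b ∷ c ∷ w) a = begin
  countUD (b ∷ c ∷ w ∷ʳ a)                          ≡⟨ countUD-∷∷ b c (w ∷ʳ a) ⟩
  isUD b c + countUD (c ∷ w ∷ʳ a)                   ≡⟨ cong (isUD b c +_) (countUD-∷ʳ (c ∷ w) a) ⟩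
  isUD b c + (countUD (c ∷ w) + isUD (final (c ∷ w)) a) ≡⟨ +-assoc (isUD b c) _ _ ⟨
  isUD b c + countUD (c ∷ w) + isUD (final (c ∷ w)) a   ≡⟨ cong (_+ _) (countUD-∷∷ b c w) ⟨
  countUD (b ∷ c ∷ w) + isUD (final (c ∷ w)) a     ∎

countUUD-pair : ∀ a b → countUUD (a ∷ b ∷ []) ≡ 0
countUUD-pair U U = refl
countUUD-pair U D = refl
countUUD-pair D U = refl
countUUD-pair D D = refl

countUUD-∷ʳ : ∀ w a b → countUUD (w ++ a ∷ b ∷ []) ≡ countUUD (w ∷ʳ a) + isUUD (final w) a b
countUUD-∷ʳ [] U U = refl
countUUD-∷ʳ [] U D = refl
countUUD-∷ʳ [] D U = refl
countUUD-∷ʳ [] D D = refl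
countUUD-∷ʳ (c ∷ []) a b = begin
  countUUD (c ∷ a ∷ b ∷ [])              ≡⟨ countUUD-∷∷ c a (b ∷ []) ⟩
  isUUD c a b + countUUD (a ∷ b ∷ [])    ≡⟨ cong (isUUD c a b +_) (countUUD-pair a b) ⟩
  isUUD c a b + 0                        ≡⟨ +-comm (isUUD c a b) 0 ⟩
  0 + isUUD c a b                        ≡⟨ cong (_+ isUUD c a b) (countUUD-pair c a) ⟨
  countUUD (c ∷ a ∷ []) + isUUD c a b    ∎
countUUD-∷ʳ (c ∷ d ∷ w) a b = begin
  countUUD (c ∷ d ∷ w ++ a ∷ b ∷ [])
    ≡⟨ countUUD-∷∷ c d (w ++ a ∷ b ∷ []) ⟩
  headUUD c d (w ++ a ∷ b ∷ []) + countUUD (d ∷ w ++ a ∷ b ∷ [])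
    ≡⟨ cong₂ _+_ (same-head w) (countUUD-∷ʳ (d ∷ w) a b) ⟩
  headUUD c d (w ∷ʳ a) + (countUUD (d ∷ w ∷ʳ a) + isUUD (final (d ∷ w)) a b)
    ≡⟨ +-assoc (headUUD c d (w ∷ʳ a)) _ _ ⟨
  headUUD c d (w ∷ʳ a) + countUUD (d ∷ w ∷ʳ a) + isUUD (final (d ∷ w)) a b
    ≡⟨ cong (_+ _) (countUUD-∷∷ c d (w ∷ʳ a)) ⟨
  countUUD (c ∷ d ∷ w ∷ʳ a) + isUUD (final (d ∷ w)) a b ∎
  where
  same-head : ∀ w → headUUD c d (w ++ a ∷ b ∷ []) ≡ headUUD c d (w ∷ʳ a)
  same-head [] = refl
  same-head (_ ∷ _) = refl

cyclicUD-rotate₁ : ∀ x → cyclicUD (rotate₁ x) ≡ cyclicUD x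
cyclicUD-rotate₁ [] = refl
cyclicUD-rotate₁ (a ∷ []) = refl
cyclicUD-rotate₁ (a ∷ b ∷ t) = begin
  countUD ((b ∷ t ∷ʳ a) ∷ʳ b)                           ≡⟨ countUD-∷ʳ (b ∷ t ∷ʳ a) b ⟩
  countUD (b ∷ t ∷ʳ a) + isUD (final (b ∷ t ∷ʳ a)) b
    ≡⟨ cong (λ c → countUD (b ∷ t ∷ʳ a) + isUD c b) (final-∷ʳ (b ∷ t) a) ⟩
  countUD (b ∷ t ∷ʳ a) + isUD a b                       ≡⟨ +-comm _ (isUD a b) ⟩
  isUD a b + countUD (b ∷ t ∷ʳ a)                       ≡⟨ countUD-∷∷ a b (t ∷ʳ a) ⟨
  countUD (a ∷ b ∷ t ∷ʳ a)                              ∎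

cyclicUUD-rotate₁ : ∀ x → cyclicUUD (rotate₁ x) ≡ cyclicUUD x
cyclicUUD-rotate₁ [] = refl
cyclicUUD-rotate₁ (a ∷ []) = refl
cyclicUUD-rotate₁ (U ∷ U ∷ []) = refl
cyclicUUD-rotate₁ (U ∷ D ∷ []) = refl
cyclicUUD-rotate₁ (D ∷ U ∷ []) = refl
cyclicUUD-rotate₁ (D ∷ D ∷ []) = refl
cyclicUUD-rotate₁ (a ∷ b ∷ c ∷ t) = begin
  countUUD ((b ∷ c ∷ t ∷ʳ a) ++ b ∷ c ∷ [])
    ≡⟨ countUUD-∷ʳ (b ∷ c ∷ t ∷ʳ a) b c ⟩
  countUUD ((b ∷ c ∷ t ∷ʳ a) ∷ʳ b) + isUUD (final (b ∷ c ∷ t ∷ʳ a)) b c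
    ≡⟨ cong₂ (λ w d → countUUD (b ∷ c ∷ w) + isUUD d b c)
             (++-assoc t (a ∷ []) (b ∷ [])) (final-∷ʳ (b ∷ c ∷ t) a) ⟩
  countUUD (b ∷ c ∷ t ++ a ∷ b ∷ []) + isUUD a b c
    ≡⟨ +-comm _ (isUUD a b c) ⟩
  isUUD a b c + countUUD (b ∷ c ∷ t ++ a ∷ b ∷ [])
    ≡⟨ countUUD-∷∷ a b (c ∷ t ++ a ∷ b ∷ []) ⟨
  countUUD (a ∷ b ∷ c ∷ t ++ a ∷ b ∷ []) ∎

isUUD-·D· : ∀ a c → isUUD a D c ≡ 0
isUUD-·D· U c = refl
isUUD-·D· D c = refl

countUD-D∷ʳ : ∀ w c → countUD ((w ∷ʳ D) ∷ʳ c) ≡ countUD (w ∷ʳ D)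
countUD-D∷ʳ w c = begin
  countUD ((w ∷ʳ D) ∷ʳ c)                          ≡⟨ countUD-∷ʳ (w ∷ʳ D) c ⟩
  countUD (w ∷ʳ D) + isUD (final (w ∷ʳ D)) c       ≡⟨ cong (λ a → countUD (w ∷ʳ D) + isUD a c) (final-∷ʳ w D) ⟩
  countUD (w ∷ʳ D) + 0                             ≡⟨ +-identityʳ _ ⟩
  countUD (w ∷ʳ D)                                 ∎

countUUD-D∷ʳ : ∀ w c → countUUD ((w ∷ʳ D) ∷ʳ c) ≡ countUUD (w ∷ʳ D)
countUUD-D∷ʳ w c = begin
  countUUD ((w ∷ʳ D) ∷ʳ c)                   ≡⟨ cong countUUD (++-assoc w (D ∷ []) (c ∷ [])) ⟩
  countUUD (w ++ D ∷ c ∷ [])                 ≡⟨ countUUD-∷ʳ w D c ⟩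
  countUUD (w ∷ʳ D) + isUUD (final w) D c    ≡⟨ cong (countUUD (w ∷ʳ D) +_) (isUUD-·D· (final w) c) ⟩
  countUUD (w ∷ʳ D) + 0                      ≡⟨ +-identityʳ _ ⟩
  countUUD (w ∷ʳ D)                          ∎

countUUD-D∷ʳ∷ʳ : ∀ w c d → countUUD ((w ∷ʳ D) ++ c ∷ d ∷ []) ≡ countUUD (w ∷ʳ D)
countUUD-D∷ʳ∷ʳ w c d = begin
  countUUD ((w ∷ʳ D) ++ c ∷ d ∷ [])                          ≡⟨ countUUD-∷ʳ (w ∷ʳ D) c d ⟩
  countUUD ((w ∷ʳ D) ∷ʳ c) + isUUD (final (w ∷ʳ D)) c d
    ≡⟨ cong₂ (λ n a → n + isUUD a c d) (countUUD-D∷ʳ w c) (final-∷ʳ w D) ⟩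
  countUUD (w ∷ʳ D) + 0                                      ≡⟨ +-identityʳ _ ⟩
  countUUD (w ∷ʳ D)                                          ∎

cyclicUD-∷ʳD : ∀ w → cyclicUD (w ∷ʳ D) ≡ countUD (w ∷ʳ D)
cyclicUD-∷ʳD [] = refl
cyclicUD-∷ʳD (c ∷ w) = countUD-D∷ʳ (c ∷ w) c

cyclicUUD-∷ʳD : ∀ w → cyclicUUD (w ∷ʳ D) ≡ countUUD (w ∷ʳ D)
cyclicUUD-∷ʳD [] = refl
cyclicUUD-∷ʳD (c ∷ []) = countUUD-D∷ʳ∷ʳ (c ∷ []) c D
cyclicUUD-∷ʳD (c ∷ d ∷ w) = countUUD-D∷ʳ∷ʳ (c ∷ d ∷ w) c d

-- Dyck paths are the words p with p ∷ʳ D exiting at its end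

prefixOK-++ : ∀ h u v → T (prefixOK h (u ++ v)) → T (prefixOK h u)
prefixOK-++ h [] v ok = tt
prefixOK-++ h (U ∷ u) v ok = prefixOK-++ (suc h) u v ok
prefixOK-++ (suc h) (D ∷ u) v ok = prefixOK-++ h u v ok

Dyck-∷ʳ-view : ∀ p → T (prefixOK 0 p) → countD p ≡ countU p → p ≡ [] ⊎ ∃ λ w → p ≡ w ∷ʳ D
Dyck-∷ʳ-view p ok balanced with reverseView p
... | [] = inj₁ refl
... | w ∶ _ ∶ʳ D = inj₂ (w , refl)
... | w ∶ _ ∶ʳ U = ⊥-elim (1+n≰n (subst (_≤ countU w) D-excess (prefixOK-counts 0 w (prefixOK-++ 0 w (U ∷ []) ok))))
  where
  D-excess : countD w ≡ suc (countU w)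
  D-excess = begin
    countD w                 ≡⟨ +-identityʳ (countD w) ⟨
    countD w + 0             ≡⟨ countD-++ w (U ∷ []) ⟨
    countD (w ∷ʳ U)          ≡⟨ balanced ⟩
    countU (w ∷ʳ U)          ≡⟨ countU-++ w (U ∷ []) ⟩
    countU w + 1             ≡⟨ +-comm (countU w) 1 ⟩
    suc (countU w)           ∎

Dyck-cyclic-stats : ∀ p → T (prefixOK 0 p) → countD p ≡ countU p →
  cyclicUD (p ∷ʳ D) ≡ countUD p × cyclicUUD (p ∷ʳ D) ≡ countUUD p
Dyck-cyclic-stats p ok balanced with Dyck-∷ʳ-view p ok balanced
... | inj₁ refl = refl , refl
... | inj₂ (w , refl) = trans (cyclicUD-∷ʳD (w ∷ʳ D)) (countUD-D∷ʳ w D) ,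
                        trans (cyclicUUD-∷ʳD (w ∷ʳ D)) (countUUD-D∷ʳ w D)

countU-∷ʳD : ∀ p → countU (p ∷ʳ D) ≡ countU p
countU-∷ʳD [] = refl
countU-∷ʳD (U ∷ p) = cong suc (countU-∷ʳD p)
countU-∷ʳD (D ∷ p) = countU-∷ʳD p

countD-∷ʳD : ∀ p → countD (p ∷ʳ D) ≡ suc (countD p)
countD-∷ʳD [] = refl
countD-∷ʳD (U ∷ p) = countD-∷ʳD p
countD-∷ʳD (D ∷ p) = cong suc (countD-∷ʳD p)

cyclicClass : ℕ → ℕ → ℕ → List Step → Bool
cyclicClass n k m x = (countU x ≡ᵇ n) ∧ (countD x ≡ᵇ suc n) ∧ (cyclicUD x ≡ᵇ k) ∧ (cyclicUUD x ≡ᵇ m)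

isDyckWithStats : ℕ → ℕ → ℕ → List Step → Bool
isDyckWithStats n k m p = isDyck n p ∧ eqᵇ (countUD p) k ∧ eqᵇ (countUUD p) m

cyclicClass-exitsAtEnd-∷ʳD : ∀ n k m p →
  (cyclicClass n k m (p ∷ʳ D) ∧ exitsAtEnd 0 (p ∷ʳ D)) ≡ isDyckWithStats n k m p
cyclicClass-exitsAtEnd-∷ʳD n k m p = T-extensional to from
  where
  to : T (cyclicClass n k m (p ∷ʳ D) ∧ exitsAtEnd 0 (p ∷ʳ D)) → T (isDyckWithStats n k m p)
  to t =
    let class , exits = T-∧-elim t
        U≡n , rest = T-∧-elim class
        D≡1+n , rest = T-∧-elim rest
        UD≡k , UUD≡m = T-∧-elim rest
        |U|≡n = trans (sym (countU-∷ʳD p)) (≡ᵇ⇒≡ _ n U≡n)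
        |D|≡n = suc-injective (trans (sym (countD-∷ʳD p)) (≡ᵇ⇒≡ _ (suc n) D≡1+n))
        ok = exitsAtEnd-prefix 0 p D [] exits
        stats = Dyck-cyclic-stats p ok (trans |D|≡n (sym |U|≡n))
    in T-∧-intro (T-∧-intro (≡⇒eqᵇ _ n |U|≡n) (T-∧-intro (≡⇒eqᵇ _ n |D|≡n) ok))
         (T-∧-intro (≡⇒eqᵇ _ k (trans (sym (proj₁ stats)) (≡ᵇ⇒≡ _ k UD≡k)))
                    (≡⇒eqᵇ _ m (trans (sym (proj₂ stats)) (≡ᵇ⇒≡ _ m UUD≡m))))
  from : T (isDyckWithStats n k m p) → T (cyclicClass n k m (p ∷ʳ D) ∧ exitsAtEnd 0 (p ∷ʳ D))
  from t =
    let dyck , stats = T-∧-elim t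
        U≡n , rest = T-∧-elim dyck
        D≡n , ok = T-∧-elim rest
        UD≡k , UUD≡m = T-∧-elim stats
        |U|≡n = eqᵇ⇒≡ _ n U≡n
        |D|≡n = eqᵇ⇒≡ _ n D≡n
        balanced = trans |D|≡n (sym |U|≡n)
        cyclic = Dyck-cyclic-stats p ok balanced
    in T-∧-intro
         (T-∧-intro (≡⇒≡ᵇ _ n (trans (countU-∷ʳD p) |U|≡n))
           (T-∧-intro (≡⇒≡ᵇ _ (suc n) (trans (countD-∷ʳD p) (cong suc |D|≡n)))
             (T-∧-intro (≡⇒≡ᵇ _ k (trans (proj₁ cyclic) (eqᵇ⇒≡ _ k UD≡k)))
                        (≡⇒≡ᵇ _ m (trans (proj₂ cyclic) (eqᵇ⇒≡ _ m UUD≡m))))))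
         (exitsAtEnd-∷ʳD 0 p ok balanced)

sumWords-exiting-class : ∀ n k m →
  sumWords (suc (n + n)) (λ x → 𝟙 (cyclicClass n k m x ∧ exitsAtEnd 0 x)) ≡ w n k m
sumWords-exiting-class n k m = begin
  sumWords (suc (n + n)) (λ x → 𝟙 (cyclicClass n k m x ∧ exitsAtEnd 0 x))
    ≡⟨ sumWords-∷ʳ (n + n) _ ⟩
  sumWords (n + n) (λ p → 𝟙 (cyclicClass n k m (p ∷ʳ U) ∧ exitsAtEnd 0 (p ∷ʳ U)))
    + sumWords (n + n) (λ p → 𝟙 (cyclicClass n k m (p ∷ʳ D) ∧ exitsAtEnd 0 (p ∷ʳ D)))
    ≡⟨ cong₂ _+_ (sumWords-zero (n + n) λ p _ → 𝟙-false (exitsAtEnd-∷ʳU 0 p ∘ proj₂ ∘ T-∧-elim))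
                 (sumWords-cong (n + n) λ p _ → cong 𝟙 (cyclicClass-exitsAtEnd-∷ʳD n k m p)) ⟩
  sumWords (n + n) (𝟙 ∘ isDyckWithStats n k m)
    ≡⟨ length-filter-T? (isDyckWithStats n k m) (words (n + n)) ⟨
  w n k m ∎

countU-rotate₁ : ∀ x → countU (rotate₁ x) ≡ countU x
countU-rotate₁ [] = refl
countU-rotate₁ (U ∷ x) = trans (countU-++ x (U ∷ [])) (+-comm (countU x) 1)
countU-rotate₁ (D ∷ x) = trans (countU-++ x (D ∷ [])) (+-identityʳ (countU x))

countD-rotate₁ : ∀ x → countD (rotate₁ x) ≡ countD x
countD-rotate₁ [] = refl
countD-rotate₁ (U ∷ x) = trans (countD-++ x (U ∷ [])) (+-identityʳ (countD x))
countD-rotate₁ (D ∷ x) = trans (countD-++ x (D ∷ [])) (+-comm (countD x) 1)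

cyclicClass-rotate₁ : ∀ n k m x → cyclicClass n k m (rotate₁ x) ≡ cyclicClass n k m x
cyclicClass-rotate₁ n k m x
  rewrite countU-rotate₁ x | countD-rotate₁ x | cyclicUD-rotate₁ x | cyclicUUD-rotate₁ x = refl

-- Words as sequences of runs of U's

-- sumWeak N s φ is the sum of φ f over the lists f of N naturals with sum s.
sumWeak : ℕ → ℕ → (List ℕ → ℕ) → ℕ
sumWeak zero zero φ = φ []
sumWeak zero (suc s) φ = 0
sumWeak (suc N) s φ = sumBelow (suc s) (λ j → sumWeak N (s ∸ j) (φ ∘ (j ∷_)))

sumWeak-cong : ∀ N s {φ ψ : List ℕ → ℕ} → (∀ f → length f ≡ N → φ f ≡ ψ f) → sumWeak N s φ ≡ sumWeak N s ψ
sumWeak-cong zero zero e = e [] refl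
sumWeak-cong zero (suc s) e = refl
sumWeak-cong (suc N) s e = sumBelow-cong (suc s) (λ j _ → sumWeak-cong N (s ∸ j) (λ g lg → e (j ∷ g) (cong suc lg)))

sumWeak-zero : ∀ N s → sumWeak N s (λ _ → 0) ≡ 0
sumWeak-zero zero zero = refl
sumWeak-zero zero (suc s) = refl
sumWeak-zero (suc N) s = sumBelow-zero (suc s) (λ j _ → sumWeak-zero N (s ∸ j))

incrHead : List ℕ → List ℕ
incrHead [] = []
incrHead (a ∷ f) = suc a ∷ f

sumWeak-suc : ∀ N s φ → sumWeak (suc N) (suc s) φ ≡ sumWeak N (suc s) (φ ∘ (0 ∷_)) + sumWeak (suc N) s (φ ∘ incrHead)
sumWeak-suc N s φ = refl

fromRuns : List ℕ → List Step
fromRuns [] = []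
fromRuns (a ∷ []) = replicate a U
fromRuns (a ∷ b ∷ f) = replicate a U ++ D ∷ fromRuns (b ∷ f)

fromRuns-suc : ∀ j g → fromRuns (suc j ∷ g) ≡ U ∷ fromRuns (j ∷ g)
fromRuns-suc j [] = refl
fromRuns-suc j (_ ∷ _) = refl

countD≤length : ∀ y → countD y ≤ length y
countD≤length [] = z≤n
countD≤length (U ∷ y) = m≤n⇒m≤1+n (countD≤length y)
countD≤length (D ∷ y) = s≤s (countD≤length y)

U-run : ∀ {N} (h : List Step → ℕ) (f : List ℕ) → length f ≡ suc N → h (U ∷ fromRuns f) ≡ h (fromRuns (incrHead f))
U-run h (j ∷ g) _ = cong h (sym (fromRuns-suc j g))

D-run : ∀ {N} (h : List Step → ℕ) (f : List ℕ) → length f ≡ suc N → h (D ∷ fromRuns f) ≡ h (fromRuns (0 ∷ f))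
D-run h (j ∷ g) _ = refl

sumWords-by-runs : ∀ d e (h : List Step → ℕ) →
  sumWords (d + e) (λ y → 𝟙 (countD y ≡ᵇ d) * h y) ≡ sumWeak (suc d) e (h ∘ fromRuns)
sumWords-by-runs zero zero h = cong (_+ 0) (+-identityʳ (h []))
sumWords-by-runs zero (suc e) h = begin
  sumWords (suc e) (λ y → 𝟙 (countD y ≡ᵇ 0) * h y)
    ≡⟨ sumWords-suc e _ ⟩
  sumWords e (λ y → 𝟙 (countD y ≡ᵇ 0) * h (U ∷ y)) + sumWords e (λ _ → 0)
    ≡⟨ cong₂ _+_ (sumWords-by-runs zero e (h ∘ (U ∷_))) (sumWords-zero e (λ _ _ → refl)) ⟩
  sumWeak 1 e (λ f → h (U ∷ fromRuns f)) + 0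
    ≡⟨ +-identityʳ _ ⟩
  sumWeak 1 e (λ f → h (U ∷ fromRuns f))
    ≡⟨ sumWeak-cong 1 e (U-run h) ⟩
  sumWeak 1 e (λ f → h (fromRuns (incrHead f)))
    ≡⟨ sumWeak-suc 0 e (h ∘ fromRuns) ⟨
  sumWeak 1 (suc e) (h ∘ fromRuns) ∎
sumWords-by-runs (suc d) zero h = begin
  sumWords (suc (d + 0)) (λ y → 𝟙 (countD y ≡ᵇ suc d) * h y)
    ≡⟨ sumWords-suc (d + 0) _ ⟩
  sumWords (d + 0) (λ y → 𝟙 (countD y ≡ᵇ suc d) * h (U ∷ y))
    + sumWords (d + 0) (λ y → 𝟙 (countD y ≡ᵇ d) * h (D ∷ y))
    ≡⟨ cong₂ _+_ (sumWords-zero (d + 0) too-few-letters) (sumWords-by-runs d zero (h ∘ (D ∷_))) ⟩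
  sumWeak (suc d) 0 (λ f → h (D ∷ fromRuns f))
    ≡⟨ sumWeak-cong (suc d) 0 (D-run h) ⟩
  sumWeak (suc d) 0 (λ f → h (fromRuns (0 ∷ f)))
    ≡⟨ +-identityʳ _ ⟨
  sumWeak (suc (suc d)) 0 (h ∘ fromRuns) ∎
  where
  too-few-letters : ∀ y → length y ≡ d + 0 → 𝟙 (countD y ≡ᵇ suc d) * h (U ∷ y) ≡ 0
  too-few-letters y |y| = cong (_* h (U ∷ y)) (𝟙-false λ t →
    1+n≰n (subst (_≤ d) (≡ᵇ⇒≡ _ (suc d) t) (subst (countD y ≤_) (trans |y| (+-identityʳ d)) (countD≤length y))))
sumWords-by-runs (suc d) (suc e) h = begin
  sumWords (suc (d + suc e)) (λ y → 𝟙 (countD y ≡ᵇ suc d) * h y)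
    ≡⟨ sumWords-suc (d + suc e) _ ⟩
  sumWords (d + suc e) (λ y → 𝟙 (countD y ≡ᵇ suc d) * h (U ∷ y))
    + sumWords (d + suc e) (λ y → 𝟙 (countD y ≡ᵇ d) * h (D ∷ y))
    ≡⟨ cong₂ _+_ (trans (cong (λ L → sumWords L (λ y → 𝟙 (countD y ≡ᵇ suc d) * h (U ∷ y))) (+-suc d e))
                        (sumWords-by-runs (suc d) e (h ∘ (U ∷_))))
                 (sumWords-by-runs d (suc e) (h ∘ (D ∷_))) ⟩
  sumWeak (suc (suc d)) e (λ f → h (U ∷ fromRuns f)) + sumWeak (suc d) (suc e) (λ f → h (D ∷ fromRuns f))
    ≡⟨ +-comm (sumWeak (suc (suc d)) e (λ f → h (U ∷ fromRuns f))) _ ⟩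
  sumWeak (suc d) (suc e) (λ f → h (D ∷ fromRuns f)) + sumWeak (suc (suc d)) e (λ f → h (U ∷ fromRuns f))
    ≡⟨ cong₂ _+_ (sumWeak-cong (suc d) (suc e) (D-run h)) (sumWeak-cong (suc (suc d)) e (U-run h)) ⟩
  sumWeak (suc d) (suc e) (λ f → h (fromRuns (0 ∷ f))) + sumWeak (suc (suc d)) e (λ f → h (fromRuns (incrHead f)))
    ≡⟨ sumWeak-suc (suc d) e (h ∘ fromRuns) ⟨
  sumWeak (suc (suc d)) (suc e) (h ∘ fromRuns) ∎

nonzeros atLeastTwos : List ℕ → ℕ
nonzeros [] = 0
nonzeros (zero ∷ f) = nonzeros f
nonzeros (suc _ ∷ f) = suc (nonzeros f)
atLeastTwos [] = 0
atLeastTwos (zero ∷ f) = atLeastTwos f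
atLeastTwos (suc zero ∷ f) = atLeastTwos f
atLeastTwos (suc (suc _) ∷ f) = suc (atLeastTwos f)

blocks : List ℕ → List Step
blocks [] = []
blocks (a ∷ f) = replicate a U ++ D ∷ blocks f

fromRuns-∷ʳD : ∀ a f → fromRuns (a ∷ f) ∷ʳ D ≡ blocks (a ∷ f)
fromRuns-∷ʳD a [] = refl
fromRuns-∷ʳD a (b ∷ f) = trans (++-assoc (replicate a U) (D ∷ fromRuns (b ∷ f)) (D ∷ []))
                               (cong (λ z → replicate a U ++ D ∷ z) (fromRuns-∷ʳD b f))

countUD-blocks : ∀ f → countUD (blocks f) ≡ nonzeros f
countUD-blocks [] = refl
countUD-blocks (zero ∷ f) = countUD-blocks f
countUD-blocks (suc a ∷ f) = trans (run a) (cong suc (countUD-blocks f))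
  where
  run : ∀ a → countUD (replicate (suc a) U ++ D ∷ blocks f) ≡ suc (countUD (blocks f))
  run zero = refl
  run (suc a) = run a

countUUD-blocks : ∀ f → countUUD (blocks f) ≡ atLeastTwos f
countUUD-blocks [] = refl
countUUD-blocks (zero ∷ f) = countUUD-blocks f
countUUD-blocks (suc zero ∷ f) = countUUD-blocks f
countUUD-blocks (suc (suc a) ∷ f) = trans (run a) (cong suc (countUUD-blocks f))
  where
  run : ∀ a → countUUD (replicate (suc (suc a)) U ++ D ∷ blocks f) ≡ suc (countUUD (blocks f))
  run zero = refl
  run (suc a) = run a

cyclicUUD-D∷ : ∀ y → cyclicUUD (D ∷ y) ≡ countUUD (y ∷ʳ D)
cyclicUUD-D∷ [] = refl
cyclicUUD-D∷ (c ∷ y) = begin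
  countUUD ((c ∷ y) ++ D ∷ c ∷ [])                       ≡⟨ countUUD-∷ʳ (c ∷ y) D c ⟩
  countUUD ((c ∷ y) ∷ʳ D) + isUUD (final (c ∷ y)) D c
    ≡⟨ cong (countUUD ((c ∷ y) ∷ʳ D) +_) (isUUD-·D· (final (c ∷ y)) c) ⟩
  countUUD ((c ∷ y) ∷ʳ D) + 0                            ≡⟨ +-identityʳ _ ⟩
  countUUD ((c ∷ y) ∷ʳ D)                                ∎

cyclic-stats-D∷fromRuns : ∀ a f →
  cyclicUD (D ∷ fromRuns (a ∷ f)) ≡ nonzeros (a ∷ f) × cyclicUUD (D ∷ fromRuns (a ∷ f)) ≡ atLeastTwos (a ∷ f)
cyclic-stats-D∷fromRuns a f =
  trans (cong countUD (fromRuns-∷ʳD a f)) (countUD-blocks (a ∷ f)) ,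
  trans (cyclicUUD-D∷ (fromRuns (a ∷ f))) (trans (cong countUUD (fromRuns-∷ʳD a f)) (countUUD-blocks (a ∷ f)))

𝟙-∧ : ∀ a b → 𝟙 (a ∧ b) ≡ 𝟙 a * 𝟙 b
𝟙-∧ true b = sym (+-identityʳ (𝟙 b))
𝟙-∧ false b = refl

countU+countD≡length : ∀ y → countU y + countD y ≡ length y
countU+countD≡length [] = refl
countU+countD≡length (U ∷ y) = cong suc (countU+countD≡length y)
countU+countD≡length (D ∷ y) = trans (+-suc (countU y) (countD y)) (cong suc (countU+countD≡length y))

cyclicStats : ℕ → ℕ → List Step → Bool
cyclicStats k m x = (cyclicUD x ≡ᵇ k) ∧ (cyclicUUD x ≡ᵇ m)

sumWords-D-class : ∀ n k m →
  sumWords (suc (n + n)) (λ x → 𝟙 (cyclicClass n k m x ∧ startsWithD x))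
    ≡ sumWeak (suc n) n (λ f → 𝟙 ((nonzeros f ≡ᵇ k) ∧ (atLeastTwos f ≡ᵇ m)))
sumWords-D-class n k m = begin
  sumWords (suc (n + n)) (λ x → 𝟙 (cyclicClass n k m x ∧ startsWithD x))
    ≡⟨ sumWords-suc (n + n) _ ⟩
  sumWords (n + n) (λ y → 𝟙 (cyclicClass n k m (U ∷ y) ∧ false))
    + sumWords (n + n) (λ y → 𝟙 (cyclicClass n k m (D ∷ y) ∧ true))
    ≡⟨ cong₂ _+_ (sumWords-zero (n + n) (λ _ _ → 𝟙-false (proj₂ ∘ T-∧-elim))) (sumWords-cong (n + n) D-first) ⟩
  sumWords (n + n) (λ y → 𝟙 (countD y ≡ᵇ n) * 𝟙 (cyclicStats k m (D ∷ y)))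
    ≡⟨ sumWords-by-runs n n (λ y → 𝟙 (cyclicStats k m (D ∷ y))) ⟩
  sumWeak (suc n) n (λ f → 𝟙 (cyclicStats k m (D ∷ fromRuns f)))
    ≡⟨ sumWeak-cong (suc n) n runs-stats ⟩
  sumWeak (suc n) n (λ f → 𝟙 ((nonzeros f ≡ᵇ k) ∧ (atLeastTwos f ≡ᵇ m))) ∎
  where
  D-first : ∀ y → length y ≡ n + n →
    𝟙 (cyclicClass n k m (D ∷ y) ∧ true) ≡ 𝟙 (countD y ≡ᵇ n) * 𝟙 (cyclicStats k m (D ∷ y))
  D-first y |y| = trans (cong 𝟙 (T-extensional to from)) (𝟙-∧ (countD y ≡ᵇ n) _)
    where
    to : T (cyclicClass n k m (D ∷ y) ∧ true) → T ((countD y ≡ᵇ n) ∧ cyclicStats k m (D ∷ y))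
    to t = proj₂ (T-∧-elim {countU y ≡ᵇ n} (proj₁ (T-∧-elim {cyclicClass n k m (D ∷ y)} t)))
    from : T ((countD y ≡ᵇ n) ∧ cyclicStats k m (D ∷ y)) → T (cyclicClass n k m (D ∷ y) ∧ true)
    from t = T-∧-intro {cyclicClass n k m (D ∷ y)} (T-∧-intro {countU y ≡ᵇ n} (≡⇒≡ᵇ _ n |U|≡n) t) tt
      where
      |U|≡n : countU y ≡ n
      |U|≡n = +-cancelʳ-≡ n (countU y) n
                (trans (cong (countU y +_) (sym (≡ᵇ⇒≡ _ n (proj₁ (T-∧-elim t))))) (trans (countU+countD≡length y) |y|))
  runs-stats : ∀ f → length f ≡ suc n →
    𝟙 (cyclicStats k m (D ∷ fromRuns f)) ≡ 𝟙 ((nonzeros f ≡ᵇ k) ∧ (atLeastTwos f ≡ᵇ m))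
  runs-stats (a ∷ f) _ = let UD , UUD = cyclic-stats-D∷fromRuns a f in
    cong₂ (λ u v → 𝟙 ((u ≡ᵇ k) ∧ (v ≡ᵇ m))) UD UUD

cyclicClass-counts : ∀ n k m x → T (cyclicClass n k m x) → countU x ≡ n × countD x ≡ suc n
cyclicClass-counts n k m x t =
  let U≡n , rest = T-∧-elim t
      D≡1+n , _ = T-∧-elim rest
  in ≡ᵇ⇒≡ _ n U≡n , ≡ᵇ⇒≡ _ (suc n) D≡1+n

[1+n]w≡sumWeak : ∀ n k m → suc n * w n k m ≡ sumWeak (suc n) n (λ f → 𝟙 ((nonzeros f ≡ᵇ k) ∧ (atLeastTwos f ≡ᵇ m)))
[1+n]w≡sumWeak n k m = *-cancelˡ-≡ _ _ L (begin
  L * (suc n * w n k m)                                   ≡⟨ *-comm-middle L (suc n) (w n k m) ⟩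
  suc n * (L * w n k m)                                   ≡⟨ cong (λ e → suc n * (L * e)) (sumWords-exiting-class n k m) ⟨
  suc n * (L * sumWords L (λ x → 𝟙 (R x ∧ exitsAtEnd 0 x))) ≡⟨ cong (suc n *_) exiting-orbits ⟨
  suc n * (1 * sumWords L (𝟙 ∘ R))                        ≡⟨ cong (suc n *_) (*-identityˡ _) ⟩
  suc n * sumWords L (𝟙 ∘ R)                              ≡⟨ D-orbits ⟩
  L * sumWords L (λ x → 𝟙 (R x ∧ startsWithD x))          ≡⟨ cong (L *_) (sumWords-D-class n k m) ⟩
  L * sumWeak (suc n) n (λ f → 𝟙 ((nonzeros f ≡ᵇ k) ∧ (atLeastTwos f ≡ᵇ m))) ∎)
  where
  L = suc (n + n)
  R = cyclicClass n k m
  *-comm-middle : ∀ a b c → a * (b * c) ≡ b * (a * c)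
  *-comm-middle = solve-∀
  orbit-length : ∀ x → length x ≡ L → ∀ g → sumBelow L g ≡ sumBelow (length x) g
  orbit-length x |x| g = cong (λ l → sumBelow l g) (sym |x|)
  exiting-orbits : 1 * sumWords L (𝟙 ∘ R) ≡ L * sumWords L (λ x → 𝟙 (R x ∧ exitsAtEnd 0 x))
  exiting-orbits = sumWords-rotation-orbits L R (exitsAtEnd 0) 1 (cyclicClass-rotate₁ n k m) λ x |x| t →
    let U≡n , D≡1+n = cyclicClass-counts n k m x t
    in trans (orbit-length x |x| _) (cycle-lemma x (trans D≡1+n (cong suc (sym U≡n))))
  D-orbits : suc n * sumWords L (𝟙 ∘ R) ≡ L * sumWords L (λ x → 𝟙 (R x ∧ startsWithD x))
  D-orbits = sumWords-rotation-orbits L R startsWithD (suc n) (cyclicClass-rotate₁ n k m) λ x |x| t →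
    trans (orbit-length x |x| _) (trans (sumBelow-startsWithD-rotate x) (proj₂ (cyclicClass-counts n k m x t)))

-- Counting compositions

allPositive : List ℕ → Bool
allPositive [] = true
allPositive (zero ∷ _) = false
allPositive (suc _ ∷ g) = allPositive g

positives : List ℕ → List ℕ
positives [] = []
positives (zero ∷ f) = positives f
positives (suc a ∷ f) = suc a ∷ positives f

-- Choosing which of the N entries are nonzero.
sumWeak-nonzeros : ∀ N s k (ψ : List ℕ → ℕ) →
  sumWeak N s (λ f → 𝟙 (nonzeros f ≡ᵇ k) * ψ (positives f)) ≡ (N C k) * sumWeak k s (λ g → 𝟙 (allPositive g) * ψ g)
sumWeak-nonzeros zero zero zero ψ = sym (+-identityʳ (1 * ψ []))
sumWeak-nonzeros zero zero (suc k) ψ = refl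
sumWeak-nonzeros zero (suc s) zero ψ = refl
sumWeak-nonzeros zero (suc s) (suc k) ψ = refl
sumWeak-nonzeros (suc N) s zero ψ = begin
  sumWeak N s (λ f → 𝟙 (nonzeros f ≡ᵇ 0) * ψ (positives f))
    + sumBelow s (λ j → sumWeak N (s ∸ suc j) (λ _ → 0))
    ≡⟨ cong₂ _+_ (sumWeak-nonzeros N s 0 ψ) (sumBelow-zero s (λ j _ → sumWeak-zero N (s ∸ suc j))) ⟩
  1 * sumWeak 0 s (λ g → 𝟙 (allPositive g) * ψ g) + 0
    ≡⟨ +-identityʳ _ ⟩
  1 * sumWeak 0 s (λ g → 𝟙 (allPositive g) * ψ g) ∎
sumWeak-nonzeros (suc N) s (suc k) ψ = begin
  sumWeak N s (λ f → 𝟙 (nonzeros f ≡ᵇ suc k) * ψ (positives f))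
    + sumBelow s (λ j → sumWeak N (s ∸ suc j) (λ f → 𝟙 (nonzeros f ≡ᵇ k) * ψ (suc j ∷ positives f)))
    ≡⟨ cong₂ _+_ (sumWeak-nonzeros N s (suc k) ψ)
                 (sumBelow-cong s (λ j _ → sumWeak-nonzeros N (s ∸ suc j) k (ψ ∘ (suc j ∷_)))) ⟩
  (N C (suc k)) * Y + sumBelow s (λ j → (N C k) * Z j)
    ≡⟨ cong ((N C (suc k)) * Y +_) (sumBelow-*ˡ s (N C k) Z) ⟩
  (N C (suc k)) * Y + (N C k) * sumBelow s Z
    ≡⟨ cong (λ z → (N C (suc k)) * Y + (N C k) * z) Y≡ΣZ ⟨
  (N C (suc k)) * Y + (N C k) * Y
    ≡⟨ *-distribʳ-+ Y (N C (suc k)) (N C k) ⟨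
  (N C (suc k) + N C k) * Y
    ≡⟨ cong (_* Y) (trans (+-comm (N C (suc k)) (N C k)) (nCk+nC[k+1]≡[n+1]C[k+1] N k)) ⟩
  (suc N C suc k) * Y ∎
  where
  Y = sumWeak (suc k) s (λ g → 𝟙 (allPositive g) * ψ g)
  Z : ℕ → ℕ
  Z j = sumWeak k (s ∸ suc j) (λ g → 𝟙 (allPositive g) * ψ (suc j ∷ g))
  Y≡ΣZ : Y ≡ sumBelow s Z
  Y≡ΣZ = cong (_+ sumBelow s Z) (sumWeak-zero k s)

sumWeak-allPositive-vanish : ∀ k s (φ : List ℕ → ℕ) → s < k → sumWeak k s (λ g → 𝟙 (allPositive g) * φ g) ≡ 0
sumWeak-allPositive-vanish (suc k) s φ s<k = sumBelow-zero (suc s) term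
  where
  term : ∀ j → j < suc s → sumWeak k (s ∸ j) (λ g → 𝟙 (allPositive (j ∷ g)) * φ (j ∷ g)) ≡ 0
  term zero _ = sumWeak-zero k s
  term (suc j) (s≤s j<s) = sumWeak-allPositive-vanish k (s ∸ suc j) (φ ∘ (suc j ∷_))
    (≤-trans (∸-monoʳ-< {o = 0} (s≤s z≤n) j<s) (s≤s⁻¹ s<k))

-- Subtracting 1 from every part of a composition into positive parts.
sumWeak-allPositive-shift : ∀ k t (φ : List ℕ → ℕ) →
  sumWeak k (k + t) (λ g → 𝟙 (allPositive g) * φ g) ≡ sumWeak k t (φ ∘ map suc)
sumWeak-allPositive-shift zero zero φ = +-identityʳ _
sumWeak-allPositive-shift zero (suc t) φ = refl
sumWeak-allPositive-shift (suc k) t φ = begin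
  sumWeak k (suc (k + t)) (λ _ → 0) + sumBelow (suc (k + t)) G
    ≡⟨ cong₂ _+_ (sumWeak-zero k (suc (k + t))) (cong (λ l → sumBelow (suc l) G) (+-comm k t)) ⟩
  sumBelow (suc t + k) G
    ≡⟨ sumBelow-+ (suc t) k G ⟩
  sumBelow (suc t) G + sumBelow k (λ r → G (suc t + r))
    ≡⟨ cong (sumBelow (suc t) G +_) (sumBelow-zero k too-large) ⟩
  sumBelow (suc t) G + 0
    ≡⟨ +-identityʳ _ ⟩
  sumBelow (suc t) G
    ≡⟨ sumBelow-cong (suc t) shifted ⟩
  sumWeak (suc k) t (φ ∘ map suc) ∎
  where
  G : ℕ → ℕ
  G j = sumWeak k (k + t ∸ j) (λ g → 𝟙 (allPositive g) * φ (suc j ∷ g))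
  too-large : ∀ r → r < k → G (suc t + r) ≡ 0
  too-large r r<k = sumWeak-allPositive-vanish k (k + t ∸ (suc t + r)) _
    (subst (k + t ∸ (suc t + r) <_) (m+n∸n≡m k t)
      (∸-monoʳ-< (s≤s (m≤m+n t r)) (subst (suc t + r ≤_) (+-comm t k) (+-monoʳ-< t r<k))))
  shifted : ∀ j → j < suc t → G j ≡ sumWeak k (t ∸ j) (λ e → φ (suc j ∷ map suc e))
  shifted j (s≤s j≤t) = trans (cong (λ s → sumWeak k s (λ g → 𝟙 (allPositive g) * φ (suc j ∷ g))) (+-∸-assoc k j≤t))
                              (sumWeak-allPositive-shift k (t ∸ j) (φ ∘ (suc j ∷_)))

compositions : ℕ → ℕ → ℕ
compositions zero zero = 1
compositions zero (suc t) = 0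
compositions (suc m) zero = 0
compositions (suc m) (suc t) = t C m

allPositive-incrHead-twice : ∀ {N} f → length f ≡ suc N →
  𝟙 (allPositive (incrHead (incrHead f))) ≡ 𝟙 (allPositive (incrHead f))
allPositive-incrHead-twice (j ∷ g) _ = refl

-- Compositions of e + 1 into m + 1 positive parts, counted by the first part.
sumWeak-allPositive-incrHead : ∀ m e → sumWeak (suc m) e (𝟙 ∘ allPositive ∘ incrHead) ≡ e C m
sumWeak-allPositive-incrHead zero zero = refl
sumWeak-allPositive-incrHead zero (suc e) =
  trans (sumWeak-cong 1 e allPositive-incrHead-twice) (sumWeak-allPositive-incrHead zero e)
sumWeak-allPositive-incrHead (suc m) zero = trans (+-identityʳ _) (trans (+-identityʳ _) (sumWeak-zero m 0))
sumWeak-allPositive-incrHead (suc m) (suc e) = begin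
  (sumWeak m (suc e) (λ _ → 0) + sumWeak (suc m) e (𝟙 ∘ allPositive ∘ incrHead))
    + sumWeak (suc (suc m)) e (λ f → 𝟙 (allPositive (incrHead (incrHead f))))
    ≡⟨ cong₂ _+_ (cong₂ _+_ (sumWeak-zero m (suc e)) (sumWeak-allPositive-incrHead m e))
                 (trans (sumWeak-cong (suc (suc m)) e allPositive-incrHead-twice) (sumWeak-allPositive-incrHead (suc m) e)) ⟩
  e C m + e C suc m
    ≡⟨ nCk+nC[k+1]≡[n+1]C[k+1] e m ⟩
  suc e C suc m ∎

sumWeak-allPositive : ∀ m t → sumWeak m t (𝟙 ∘ allPositive) ≡ compositions m t
sumWeak-allPositive zero zero = refl
sumWeak-allPositive zero (suc t) = refl
sumWeak-allPositive (suc m) zero = trans (+-identityʳ _) (sumWeak-zero m 0)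
sumWeak-allPositive (suc m) (suc t) =
  trans (cong (_+ sumWeak (suc m) t (𝟙 ∘ allPositive ∘ incrHead)) (sumWeak-zero m (suc t)))
        (sumWeak-allPositive-incrHead m t)

atLeastTwos-positives : ∀ f → atLeastTwos (positives f) ≡ atLeastTwos f
atLeastTwos-positives [] = refl
atLeastTwos-positives (zero ∷ f) = atLeastTwos-positives f
atLeastTwos-positives (suc zero ∷ f) = atLeastTwos-positives f
atLeastTwos-positives (suc (suc _) ∷ f) = cong suc (atLeastTwos-positives f)

atLeastTwos-map-suc : ∀ e → atLeastTwos (map suc e) ≡ nonzeros e
atLeastTwos-map-suc [] = refl
atLeastTwos-map-suc (zero ∷ e) = atLeastTwos-map-suc e
atLeastTwos-map-suc (suc _ ∷ e) = cong suc (atLeastTwos-map-suc e)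

weight : ℕ → ℕ → ℕ → ℕ
weight k t m = (k C m) * compositions m t

sumWeak-nonzeros-atLeastTwos : ∀ N k t m →
  sumWeak N (k + t) (λ f → 𝟙 ((nonzeros f ≡ᵇ k) ∧ (atLeastTwos f ≡ᵇ m))) ≡ (N C k) * weight k t m
sumWeak-nonzeros-atLeastTwos N k t m = begin
  sumWeak N (k + t) (λ f → 𝟙 ((nonzeros f ≡ᵇ k) ∧ (atLeastTwos f ≡ᵇ m)))
    ≡⟨ sumWeak-cong N (k + t) (λ f _ → trans (𝟙-∧ (nonzeros f ≡ᵇ k) _)
                                         (cong (λ a → 𝟙 (nonzeros f ≡ᵇ k) * 𝟙 (a ≡ᵇ m)) (sym (atLeastTwos-positives f)))) ⟩
  sumWeak N (k + t) (λ f → 𝟙 (nonzeros f ≡ᵇ k) * 𝟙 (atLeastTwos (positives f) ≡ᵇ m))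
    ≡⟨ sumWeak-nonzeros N (k + t) k (λ g → 𝟙 (atLeastTwos g ≡ᵇ m)) ⟩
  (N C k) * sumWeak k (k + t) (λ g → 𝟙 (allPositive g) * 𝟙 (atLeastTwos g ≡ᵇ m))
    ≡⟨ cong ((N C k) *_) (sumWeak-allPositive-shift k t (λ g → 𝟙 (atLeastTwos g ≡ᵇ m))) ⟩
  (N C k) * sumWeak k t (λ e → 𝟙 (atLeastTwos (map suc e) ≡ᵇ m))
    ≡⟨ cong ((N C k) *_) (sumWeak-cong k t (λ e _ →
         trans (cong (λ a → 𝟙 (a ≡ᵇ m)) (atLeastTwos-map-suc e)) (sym (*-identityʳ _)))) ⟩
  (N C k) * sumWeak k t (λ e → 𝟙 (nonzeros e ≡ᵇ m) * 1)
    ≡⟨ cong ((N C k) *_) (sumWeak-nonzeros k t m (λ _ → 1)) ⟩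
  (N C k) * ((k C m) * sumWeak m t (λ g → 𝟙 (allPositive g) * 1))
    ≡⟨ cong (λ c → (N C k) * ((k C m) * c))
         (trans (sumWeak-cong m t (λ g _ → *-identityʳ _)) (sumWeak-allPositive m t)) ⟩
  (N C k) * weight k t m ∎

[1+n]w≡C*weight : ∀ k t m → suc (k + t) * w (k + t) k m ≡ (suc (k + t) C k) * weight k t m
[1+n]w≡C*weight k t m = trans ([1+n]w≡sumWeak (k + t) k m) (sumWeak-nonzeros-atLeastTwos (suc (k + t)) k t m)

symmetric-ℕ-supported : ∀ (a : ℤ → ℕ) c → (∀ j → a -[1+ j ] ≡ 0) → (∀ m → c < m → a (ℤ.+ m) ≡ 0) →
  (∀ x y → x + y ≡ c → a (ℤ.+ x) ≡ a (ℤ.+ y)) → Symmetric a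
symmetric-ℕ-supported a c negative above pairs = ℤ.+ c , reflect
  where
  negative′ : ∀ d → 0 < d → a (ℤ.- (ℤ.+ d)) ≡ 0
  negative′ (suc d) _ = negative d
  reflect : ∀ i → a i ≡ a (ℤ.+ c ℤ.- i)
  reflect (ℤ.+ x) with x ≤? c
  ... | yes x≤c = trans (pairs x (c ∸ x) (m+[n∸m]≡n x≤c)) (cong a (sym (trans (m-n≡m⊖n c x) (≤-⊖ x≤c))))
  ... | no x≰c = trans (above x c<x)
                  (sym (trans (cong a (trans (m-n≡m⊖n c x) (⊖-< c<x))) (negative′ (x ∸ c) (m<n⇒0<n∸m c<x))))
    where
    c<x : c < x
    c<x = ≰⇒> x≰c
  reflect -[1+ j ] = trans (negative j) (sym (above (c + suc j) (m<m+n c (s≤s z≤n))))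

C-complement : ∀ {n a b} → a + b ≡ n → n C a ≡ n C b
C-complement {a = a} {b} refl = trans (nCk≡nC[n∸k] (m≤m+n a b)) (cong ((a + b) C_) (m+n∸m≡n a b))

pairs-symmetric : ∀ (f : ℕ → ℕ) c → f 0 ≡ f c → (∀ a b → suc a + suc b ≡ c → f (suc a) ≡ f (suc b)) →
  ∀ a b → a + b ≡ c → f a ≡ f b
pairs-symmetric f c ends inner zero b refl = ends
pairs-symmetric f c ends inner (suc a) zero a+0≡c = sym (trans ends (cong f (sym (trans (sym (+-identityʳ (suc a))) a+0≡c))))
pairs-symmetric f c ends inner (suc a) (suc b) a+b≡c = inner a b a+b≡c

weight[k,k+1]-symmetric : ∀ k a b → a + b ≡ suc k → weight k (suc k) a ≡ weight k (suc k) b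
weight[k,k+1]-symmetric k = pairs-symmetric (weight k (suc k)) (suc k) (sym (cong (_* (k C k)) (k>n⇒nCk≡0 (n<1+n k)))) inner
  where
  inner : ∀ a b → suc a + suc b ≡ suc k → (k C suc a) * (k C a) ≡ (k C suc b) * (k C b)
  inner a b a+b≡k = begin
    (k C suc a) * (k C a) ≡⟨ cong₂ _*_ (C-complement {a = suc a} (trans (sym (+-suc a b)) k≡)) (C-complement {a = a} k≡) ⟩
    (k C b) * (k C suc b) ≡⟨ *-comm (k C b) (k C suc b) ⟩
    (k C suc b) * (k C b) ∎
    where
    k≡ : a + suc b ≡ k
    k≡ = suc-injective a+b≡k

weight[k,k-1]-symmetric : ∀ j a b → a + b ≡ suc (suc j) →
  weight (suc (suc j)) (suc j) a ≡ weight (suc (suc j)) (suc j) b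
weight[k,k-1]-symmetric j = pairs-symmetric (weight K (suc j)) K
  (sym (trans (cong ((K C K) *_) (k>n⇒nCk≡0 (n<1+n j))) (*-zeroʳ (K C K))))
  (λ a b a+b≡K → cong₂ _*_ (C-complement {a = suc a} a+b≡K)
                           (C-complement {a = a} (suc-injective (trans (sym (+-suc a b)) (suc-injective a+b≡K)))))
  where
  K = suc (suc j)

weight-vanish : ∀ k t m → k < m → weight k t m ≡ 0
weight-vanish k t m k<m = cong (_* compositions m t) (k>n⇒nCk≡0 k<m)

Wcoef≡w : ∀ n k m → (k < m → w n k m ≡ 0) → Wcoef n k (ℤ.+ m) ≡ w n k m
Wcoef≡w n k m vanish with m ≤ᵇ k in m≤ᵇk
... | true = refl
... | false = sym (vanish (≰⇒> λ m≤k → subst T m≤ᵇk (≤⇒≤ᵇ m≤k)))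

w-cong-weight : ∀ k t m m′ → weight k t m ≡ weight k t m′ → w (k + t) k m ≡ w (k + t) k m′
w-cong-weight k t m m′ eq = *-cancelˡ-≡ _ _ (suc (k + t))
  (trans ([1+n]w≡C*weight k t m) (trans (cong ((suc (k + t) C k) *_) eq) (sym ([1+n]w≡C*weight k t m′))))

w-vanish : ∀ k t m → weight k t m ≡ 0 → w (k + t) k m ≡ 0
w-vanish k t m eq = *-cancelˡ-≡ _ 0 (suc (k + t))
  (trans ([1+n]w≡C*weight k t m)
    (trans (cong ((suc (k + t) C k) *_) eq) (trans (*-zeroʳ (suc (k + t) C k)) (sym (*-zeroʳ (suc (k + t)))))))

Wcoef-symmetric : ∀ k t c → (∀ m → c < m → weight k t m ≡ 0) →
  (∀ a b → a + b ≡ c → weight k t a ≡ weight k t b) → Symmetric (Wcoef (k + t) k)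
Wcoef-symmetric k t c above pairs = symmetric-ℕ-supported (Wcoef (k + t) k) c (λ _ → refl)
  (λ m c<m → trans (coefficient m) (w-vanish k t m (above m c<m)))
  (λ a b a+b≡c → trans (coefficient a) (trans (w-cong-weight k t a b (pairs a b a+b≡c)) (sym (coefficient b))))
  where
  coefficient : ∀ m → Wcoef (k + t) k (ℤ.+ m) ≡ w (k + t) k m
  coefficient m = Wcoef≡w (k + t) k m (w-vanish k t m ∘ weight-vanish k t m)

Wcoef[k+[k+1]]-symmetric : ∀ k → Symmetric (Wcoef (k + suc k) k)
Wcoef[k+[k+1]]-symmetric k = Wcoef-symmetric k (suc k) (suc k)
  (λ m 1+k<m → weight-vanish k (suc k) m (<-trans (n<1+n k) 1+k<m)) (weight[k,k+1]-symmetric k)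

-- For k = 1 the polynomial is the constant 1, symmetric about 0 rather than k.
Wcoef[k+[k-1]]-symmetric : ∀ j → Symmetric (Wcoef (suc j + j) (suc j))
Wcoef[k+[k-1]]-symmetric zero = Wcoef-symmetric 1 0 0 (λ { (suc m) _ → *-zeroʳ (1 C suc m) }) (λ { zero zero _ → refl })
Wcoef[k+[k-1]]-symmetric (suc i) = Wcoef-symmetric (suc (suc i)) (suc i) (suc (suc i))
  (weight-vanish (suc (suc i)) (suc i)) (weight[k,k-1]-symmetric i)

proposition6p7 : (k : ℕ) → 1 ≤ k →
    Symmetric (Wcoef (2 * k + 1) k) × Symmetric (Wcoef (2 * k ∸ 1) k)
proposition6p7 k@(suc j) _ =
  subst (λ n → Symmetric (Wcoef n k)) (sym (2k+1≡k+[k+1] k)) (Wcoef[k+[k+1]]-symmetric k) ,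
  subst (λ n → Symmetric (Wcoef n k)) (sym (2k-1≡k+[k-1] j)) (Wcoef[k+[k-1]]-symmetric j)
  where
  2k+1≡k+[k+1] : ∀ k → 2 * k + 1 ≡ k + suc k
  2k+1≡k+[k+1] = solve-∀
  2k-1≡k+[k-1] : ∀ j → 2 * suc j ∸ 1 ≡ suc j + j
  2k-1≡k+[k-1] j = trans (+-suc j (j + 0)) (cong (λ i → suc (j + i)) (+-identityʳ j))
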